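{- Let $G$ be a graph with at least one edge and $k\ge 1$. Then $G$ admits a $k$-super graceful labeling in which all edge labels are odd if and only if $k=1$ and $G$ is a star $K(1,q)$ for some $q\ge 1$.
   Context: All graphs are simple, finite, undirected and without isolated vertices. For integers $a\le b$, $[a,b]$ is the set of integers between $a$ and $b$ inclusive. For $k\ge 1$, a $k$-super graceful labeling of a graph $G=(V,E)$ with $p$ vertices and $q$ edges is a bijection $f:V\cup E\to[k,k+p+q-1]$ with $f(uv)=|f(u)-f(v)|$ for every edge $uv$. $K(1,q)$ is the star with $q$ edges. -}

module Defs where

open import Data.Nat using (ℕ; zero; suc; _+_; _∸_; _*_; _≤_; _<_; ∣_-_∣)
open import Data.Fin using (Fin; zero; suc)
open import Data.Sum using (_⊎_; inj₁; inj₂)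
open import Data.Product using (Σ; _×_; _,_; ∃)
open import Relation.Binary.PropositionalEquality using (_≡_; _≢_)
open import Function.Bundles using (_↔_; Inverse)
open import Function.Definitions using (Injective)

record Graph : Set where
  field
    p : ℕ
    q : ℕ
    src : Fin q → Fin p
    tgt : Fin q → Fin p
    loopless : ∀ e → src e ≢ tgt e
    simple : ∀ e e′ → ((src e ≡ src e′ × tgt e ≡ tgt e′) ⊎ (src e ≡ tgt e′ × tgt e ≡ src e′)) → e ≡ e′
    noIsolated : ∀ v → ∃ λ e → (src e ≡ v) ⊎ (tgt e ≡ v)

open Graph public

Adj : (G : Graph) → Fin (p G) → Fin (p G) → Set
Adj G u v = ∃ λ e → (src G e ≡ u × tgt G e ≡ v) ⊎ (src G e ≡ v × tgt G e ≡ u)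

StarAdj : {q : ℕ} → Fin (suc q) → Fin (suc q) → Set
StarAdj a b = (a ≡ zero × b ≢ zero) ⊎ (b ≡ zero × a ≢ zero)

IsStar : Graph → Set
IsStar G = Σ ℕ λ q′ → (1 ≤ q′) × Σ (Fin (p G) ↔ Fin (suc q′)) λ σ →
  ∀ u v → (Adj G u v → StarAdj (Inverse.to σ u) (Inverse.to σ v))
        × (StarAdj (Inverse.to σ u) (Inverse.to σ v) → Adj G u v)

Elem : Graph → Set
Elem G = Fin (p G) ⊎ Fin (q G)

record SuperGraceful (k : ℕ) (G : Graph) : Set where
  field
    f : Elem G → ℕ
    injective : Injective _≡_ _≡_ f
    inRange : ∀ x → k ≤ f x × f x ≤ k + p G + q G ∸ 1
    onto : ∀ n → k ≤ n → n ≤ k + p G + q G ∸ 1 → ∃ λ x → f x ≡ n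
    edgeLabel : ∀ e → f (inj₂ e) ≡ ∣ f (inj₁ (src G e)) - f (inj₁ (tgt G e)) ∣

data Odd : ℕ → Set where
  odd : ∀ m → Odd (suc (2 * m))

HasOddEdgeSGL : ℕ → Graph → Set
HasOddEdgeSGL k G = Σ (SuperGraceful k G) λ L → ∀ e → Odd (SuperGraceful.f L (inj₂ e))

module Submission where

-- (⇒) An odd edge label |f(u) - f(v)| forces the endpoints u, v to carry
-- labels of opposite parity.  Fix an odd vertex c and let M = k+p+q-1 be the
-- top label.  The map T on V ∪ E sending an even vertex to an incident edge,
-- an odd element labelled n < M to the element labelled n+1, and the element
-- labelled M to c is injective; V ∪ E being finite, T is onto.  The only value
-- of T that is an odd vertex is c (and only when M is odd), so c is the unique
-- odd vertex, M is odd, and every edge meets c: G is a star centred at c.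
-- Then c carries M, the element labelled M-1 is an even leaf, and its edge is
-- labelled 1; hence k ≤ 1.
-- (⇐) Label the centre of K(1,q) by 2q+1, the leaves by 2,4,...,2q and the
-- edges by the differences 2q-1,...,3,1; transport along the isomorphism.

open import Defs
open import Data.Bool using (Bool; true; false; not; _xor_)
open import Data.Bool.Properties
  using (xor-same; xor-identityʳ; not-distribˡ-xor; not-distribʳ-xor; not-involutive)
  renaming (_≟_ to _≟ᵇ_)
open import Data.Fin using (Fin; zero; suc; toℕ; fromℕ<; punchOut; opposite)
open import Data.Fin.Properties
  using (+↔⊎; toℕ-injective; toℕ<n; toℕ-fromℕ<; injective⇒≤; punchOut-injective;
         cantor-schröder-bernstein; opposite-prop; opposite-involutive)
  renaming (_≟_ to _≟ᶠ_; suc-injective to Fin-suc-injective; 0≢1+n to zero≢suc)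
open import Data.Nat using (ℕ; zero; suc; _+_; _∸_; _*_; _≤_; _<_; ∣_-_∣; z≤n; s≤s; _<?_)
open import Data.Nat.Properties
open import Data.Product using (_×_; _,_; ∃; proj₁; proj₂)
import Data.Product as Product
open import Data.Sum using (_⊎_; inj₁; inj₂)
import Data.Sum as Sum
open import Data.Sum.Properties using (inj₁-injective; inj₂-injective)
open import Data.Sum.Function.Propositional using (_⊎-↔_)
open import Function.Bundles using (_⇔_; _↔_; Inverse; Injection; mk⇔; mk↔ₛ′)
open import Function.Definitions using (Injective)
open import Function.Properties.Inverse using (↔⇒↣; ↔-sym)
open import Relation.Binary.PropositionalEquality
open import Relation.Nullary using (¬_; yes; no; contradiction)
open import Relation.Nullary.Decidable using (decidable-stable; _×-dec_)

isOdd : ℕ → Bool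
isOdd zero    = false
isOdd (suc n) = not (isOdd n)

isOdd-+ : ∀ m n → isOdd (m + n) ≡ isOdd m xor isOdd n
isOdd-+ zero    n = refl
isOdd-+ (suc m) n = trans (cong not (isOdd-+ m n)) (not-distribˡ-xor (isOdd m) (isOdd n))

isOdd-double : ∀ m → isOdd (2 * m) ≡ false
isOdd-double m = begin
  isOdd (m + (m + 0))       ≡⟨ cong (λ z → isOdd (m + z)) (+-identityʳ m) ⟩
  isOdd (m + m)             ≡⟨ isOdd-+ m m ⟩
  isOdd m xor isOdd m       ≡⟨ xor-same (isOdd m) ⟩
  false                     ∎
  where open ≡-Reasoning

Odd⇒isOdd : ∀ {n} → Odd n → isOdd n ≡ true
Odd⇒isOdd (odd m) = cong not (isOdd-double m)

isOdd-∣-∣ : ∀ a b → isOdd ∣ a - b ∣ ≡ isOdd a xor isOdd b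
isOdd-∣-∣ zero    b       = refl
isOdd-∣-∣ (suc a) zero    = sym (xor-identityʳ (not (isOdd a)))
isOdd-∣-∣ (suc a) (suc b) = begin
  isOdd ∣ a - b ∣                   ≡⟨ isOdd-∣-∣ a b ⟩
  isOdd a xor isOdd b               ≡⟨ not-involutive _ ⟨
  not (not (isOdd a xor isOdd b))   ≡⟨ cong not (not-distribʳ-xor (isOdd a) (isOdd b)) ⟩
  not (isOdd a xor not (isOdd b))   ≡⟨ not-distribˡ-xor (isOdd a) (not (isOdd b)) ⟩
  not (isOdd a) xor not (isOdd b)   ∎
  where open ≡-Reasoning

xor≡true : ∀ a {b} → a xor b ≡ true → b ≡ not a
xor≡true true  {false} _  = refl
xor≡true true  {true}  ()
xor≡true false         eq = eq

true≢false : true ≢ false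
true≢false ()

odd≢even : ∀ {a b} → isOdd a ≡ true → isOdd b ≡ false → a ≢ b
odd≢even pa pb refl = true≢false (trans (sym pa) pb)

double≢odd : ∀ a b → 2 * a ≢ suc (2 * b)
double≢odd a b eq = odd≢even (cong not (isOdd-double b)) (isOdd-double a) (sym eq)

evenOrOdd : ∀ m → ∃ λ t → (m ≡ 2 * t) ⊎ (m ≡ suc (2 * t))
evenOrOdd zero = 0 , inj₁ refl
evenOrOdd (suc m) with evenOrOdd m
... | t , inj₁ m≡2t = t , inj₂ (cong suc m≡2t)
... | t , inj₂ m≡2t+1 = suc t , inj₁ (cong suc (trans m≡2t+1 (sym (+-suc t (t + 0)))))

∣-∣<top : ∀ {a b M} → 1 ≤ a → 1 ≤ b → a ≤ M → b ≤ M → ∣ a - b ∣ < M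
∣-∣<top {suc a} {suc b} _ _ a≤M b≤M = ≤-trans (s≤s (∣m-n∣≤m⊔n a b)) (⊔-lub a≤M b≤M)

suc-∸1 : ∀ {n} → 1 ≤ n → suc (n ∸ 1) ≡ n
suc-∸1 (s≤s _) = refl

∣suc-n-n∣ : ∀ n → ∣ suc n - n ∣ ≡ 1
∣suc-n-n∣ n = trans (m≤n⇒∣n-m∣≡n∸m (n≤1+n n)) (m+n∸n≡m 1 n)

k<top : ∀ k {p q} → 1 ≤ p → 1 ≤ q → k < k + p + q ∸ 1
k<top k {suc p} {suc q} _ _ = begin-strict
  k                     <⟨ m<m+n k (s≤s z≤n) ⟩
  k + suc p             ≤⟨ m≤m+n (k + suc p) q ⟩
  k + suc p + q         ≡⟨ cong (_∸ 1) (+-suc (k + suc p) q) ⟨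
  k + suc p + suc q ∸ 1 ∎
  where open ≤-Reasoning

fin-injective⇒noGap : ∀ {n} (g : Fin n → Fin n) → Injective _≡_ _≡_ g →
                      ∀ y → ¬ (∀ x → g x ≢ y)
fin-injective⇒noGap {suc n} g g-inj y miss = 1+n≰n (injective⇒≤ gᵒ-inj)
  where
  y≢g : ∀ x → y ≢ g x
  y≢g x y≡gx = miss x (sym y≡gx)
  -- g with the missed point y squeezed out, an injection Fin (suc n) → Fin n
  gᵒ : Fin (suc n) → Fin n
  gᵒ x = punchOut (y≢g x)
  gᵒ-inj : Injective _≡_ _≡_ gᵒ
  gᵒ-inj {a} {b} eq = g-inj (punchOut-injective (y≢g a) (y≢g b) eq)

injective⇒noGap : ∀ {n} {A : Set} → Fin n ↔ A → (g : A → A) → Injective _≡_ _≡_ g →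
                  ∀ y → ¬ (∀ x → g x ≢ y)
injective⇒noGap ι g g-inj y miss =
  fin-injective⇒noGap h h-inj (from y) (λ i hi≡y → miss (to i) (from-inj hi≡y))
  where
  open Inverse ι
  from-inj : Injective _≡_ _≡_ from
  from-inj = Injection.injective (↔⇒↣ (↔-sym ι))
  h : Fin _ → Fin _
  h i = from (g (to i))
  h-inj : Injective _≡_ _≡_ h
  h-inj eq = Injection.injective (↔⇒↣ ι) (g-inj (from-inj eq))

↔-size : ∀ {m n} → Fin m ↔ Fin n → m ≡ n
↔-size ι = cantor-schröder-bernstein (Injection.injective (↔⇒↣ ι))
                                     (Injection.injective (↔⇒↣ (↔-sym ι)))

SamePair : {A : Set} → A → A → A → A → Set
SamePair x y a b = (x ≡ a × y ≡ b) ⊎ (x ≡ b × y ≡ a)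

Joins : (G : Graph) → Fin (q G) → Fin (p G) → Fin (p G) → Set
Joins G e = SamePair (src G e) (tgt G e)

Touches : (G : Graph) → Fin (q G) → Fin (p G) → Set
Touches G e v = (src G e ≡ v) ⊎ (tgt G e ≡ v)

incidentEdge : (G : Graph) → Fin (p G) → Fin (q G)
incidentEdge G v = proj₁ (noIsolated G v)

incidentEdge-touches : (G : Graph) (v : Fin (p G)) → Touches G (incidentEdge G v) v
incidentEdge-touches G v = proj₂ (noIsolated G v)

joins-unique : ∀ (G : Graph) {e e′ a b} → Joins G e a b → Joins G e′ a b → e ≡ e′
joins-unique G {e} {e′} (inj₁ (s , t)) (inj₁ (s′ , t′)) = simple G e e′ (inj₁ (trans s (sym s′) , trans t (sym t′)))
joins-unique G {e} {e′} (inj₁ (s , t)) (inj₂ (s′ , t′)) = simple G e e′ (inj₂ (trans s (sym t′) , trans t (sym s′)))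
joins-unique G {e} {e′} (inj₂ (s , t)) (inj₁ (s′ , t′)) = simple G e e′ (inj₂ (trans s (sym t′) , trans t (sym s′)))
joins-unique G {e} {e′} (inj₂ (s , t)) (inj₂ (s′ , t′)) = simple G e e′ (inj₁ (trans s (sym s′) , trans t (sym t′)))

joins-other : ∀ (G : Graph) {e a b b′} → Joins G e a b → Joins G e a b′ → b ≡ b′
joins-other G (inj₁ (s , t)) (inj₁ (s′ , t′)) = trans (sym t) t′
joins-other G (inj₁ (s , t)) (inj₂ (s′ , t′)) = trans (sym t) (trans t′ (trans (sym s) s′))
joins-other G (inj₂ (s , t)) (inj₁ (s′ , t′)) = trans (sym s) (trans s′ (trans (sym t) t′))
joins-other G (inj₂ (s , t)) (inj₂ (s′ , t′)) = trans (sym s) s′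

joins-distance : ∀ (G : Graph) (g : Fin (p G) → ℕ) {e a b} → Joins G e a b →
                 ∣ g (src G e) - g (tgt G e) ∣ ≡ ∣ g a - g b ∣
joins-distance G g (inj₁ (refl , refl)) = refl
joins-distance G g (inj₂ (refl , refl)) = ∣-∣-comm (g _) (g _)

starAdj-leaf : ∀ {n} {a b : Fin (suc n)} → StarAdj a b → ∃ λ j → SamePair a b zero (suc j)
starAdj-leaf {b = suc j} (inj₁ (refl , _))   = j , inj₁ (refl , refl)
starAdj-leaf {b = zero}  (inj₁ (_ , b≢zero)) = contradiction refl b≢zero
starAdj-leaf {a = suc j} (inj₂ (refl , _))   = j , inj₂ (refl , refl)
starAdj-leaf {a = zero}  (inj₂ (_ , a≢zero)) = contradiction refl a≢zero

module Centred (G : Graph) (c : Fin (p G)) (central : ∀ e → Touches G e c) where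

  joins-centre : ∀ {e u v} → Joins G e u v → (u ≡ c × v ≢ c) ⊎ (v ≡ c × u ≢ c)
  joins-centre {e} (inj₁ (refl , refl)) with central e
  ... | inj₁ s≡c = inj₁ (s≡c , λ t≡c → loopless G e (trans s≡c (sym t≡c)))
  ... | inj₂ t≡c = inj₂ (t≡c , λ s≡c → loopless G e (trans s≡c (sym t≡c)))
  joins-centre {e} (inj₂ (refl , refl)) with central e
  ... | inj₁ s≡c = inj₂ (s≡c , λ t≡c → loopless G e (trans s≡c (sym t≡c)))
  ... | inj₂ t≡c = inj₁ (t≡c , λ s≡c → loopless G e (trans s≡c (sym t≡c)))

  spoke : ∀ {v} → v ≢ c → Joins G (incidentEdge G v) c v
  spoke {v} v≢c with incidentEdge-touches G v | central (incidentEdge G v)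
  ... | inj₁ s≡v | inj₁ s≡c = contradiction (trans (sym s≡v) s≡c) v≢c
  ... | inj₁ s≡v | inj₂ t≡c = inj₂ (s≡v , t≡c)
  ... | inj₂ t≡v | inj₁ s≡c = inj₁ (s≡c , t≡v)
  ... | inj₂ t≡v | inj₂ t≡c = contradiction (trans (sym t≡v) t≡c) v≢c

  farEnd : Fin (q G) → Fin (p G)
  farEnd e with src G e ≟ᶠ c
  ... | yes _ = tgt G e
  ... | no  _ = src G e

  farEnd-joins : ∀ e → Joins G e c (farEnd e)
  farEnd-joins e with src G e ≟ᶠ c | central e
  ... | yes s≡c | _        = inj₁ (s≡c , refl)
  ... | no  s≢c | inj₁ s≡c = contradiction s≡c s≢c
  ... | no  s≢c | inj₂ t≡c = inj₂ (refl , t≡c)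

  toStar : Fin (p G) → Fin (suc (q G))
  toStar v with v ≟ᶠ c
  ... | yes _ = zero
  ... | no  _ = suc (incidentEdge G v)

  fromStar : Fin (suc (q G)) → Fin (p G)
  fromStar zero    = c
  fromStar (suc e) = farEnd e

  toStar-centre : toStar c ≡ zero
  toStar-centre with c ≟ᶠ c
  ... | yes _   = refl
  ... | no  c≢c = contradiction refl c≢c

  toStar-leaf : ∀ {v} → v ≢ c → toStar v ≡ suc (incidentEdge G v)
  toStar-leaf {v} v≢c with v ≟ᶠ c
  ... | yes v≡c = contradiction v≡c v≢c
  ... | no  _   = refl

  toStar-zero : ∀ {v} → toStar v ≡ zero → v ≡ c
  toStar-zero {v} eq with v ≟ᶠ c
  ... | yes v≡c = v≡c
  toStar-zero {v} () | no _

  toStar-fromStar : ∀ y → toStar (fromStar y) ≡ y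
  toStar-fromStar zero    = toStar-centre
  toStar-fromStar (suc e) with joins-centre (farEnd-joins e)
  ... | inj₁ (_ , far≢c) = trans (toStar-leaf far≢c)
                                  (cong suc (joins-unique G (spoke far≢c) (farEnd-joins e)))
  ... | inj₂ (_ , c≢c) = contradiction refl c≢c

  fromStar-toStar : ∀ v → fromStar (toStar v) ≡ v
  fromStar-toStar v with v ≟ᶠ c
  ... | yes v≡c = sym v≡c
  ... | no  v≢c = joins-other G (farEnd-joins _) (spoke v≢c)

  toStar-adj : ∀ {u v} → Adj G u v → StarAdj (toStar u) (toStar v)
  toStar-adj (_ , u~v) with joins-centre u~v
  ... | inj₁ (refl , v≢c) = inj₁ (toStar-centre , λ eq → v≢c (toStar-zero eq))
  ... | inj₂ (refl , u≢c) = inj₂ (toStar-centre , λ eq → u≢c (toStar-zero eq))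

  fromStar-adj : ∀ {u v} → StarAdj (toStar u) (toStar v) → Adj G u v
  fromStar-adj (inj₁ (u₀ , v≢₀)) with toStar-zero u₀
  ... | refl = incidentEdge G _ , spoke (λ v≡c → v≢₀ (trans (cong toStar v≡c) toStar-centre))
  fromStar-adj (inj₂ (v₀ , u≢₀)) with toStar-zero v₀
  ... | refl = incidentEdge G _ , Sum.swap (spoke (λ u≡c → u≢₀ (trans (cong toStar u≡c) toStar-centre)))

  isStar : 1 ≤ q G → IsStar G
  isStar q≥1 = q G , q≥1 , mk↔ₛ′ toStar fromStar toStar-fromStar fromStar-toStar ,
               λ u v → toStar-adj , fromStar-adj

module OddEdgeLabelling (G : Graph) (q≥1 : 1 ≤ q G) (k : ℕ) (k≥1 : 1 ≤ k)
       (L : SuperGraceful k G) (odd-edges : ∀ e → Odd (SuperGraceful.f L (inj₂ e))) where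

  open SuperGraceful L

  M : ℕ
  M = k + p G + q G ∸ 1

  fv : Fin (p G) → ℕ
  fv v = f (inj₁ v)

  isOdd-edge : ∀ e → isOdd (f (inj₂ e)) ≡ true
  isOdd-edge e = Odd⇒isOdd (odd-edges e)

  ends-opposite : ∀ e → isOdd (fv (tgt G e)) ≡ not (isOdd (fv (src G e)))
  ends-opposite e = xor≡true _ (begin
    isOdd (fv (src G e)) xor isOdd (fv (tgt G e)) ≡⟨ isOdd-∣-∣ (fv (src G e)) (fv (tgt G e)) ⟨
    isOdd ∣ fv (src G e) - fv (tgt G e) ∣         ≡⟨ cong isOdd (edgeLabel e) ⟨
    isOdd (f (inj₂ e))                            ≡⟨ isOdd-edge e ⟩
    true                                          ∎)
    where open ≡-Reasoning

  oddEnd : ∀ e → ∃ λ v → Touches G e v × isOdd (fv v) ≡ true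
  oddEnd e with isOdd (fv (src G e)) in ps
  ... | true  = src G e , inj₁ refl , ps
  ... | false = tgt G e , inj₂ refl , trans (ends-opposite e) (cong not ps)

  evenEnd-unique : ∀ {e v w} → Touches G e v → Touches G e w →
                   isOdd (fv v) ≡ false → isOdd (fv w) ≡ false → v ≡ w
  evenEnd-unique (inj₁ refl) (inj₁ refl) _  _  = refl
  evenEnd-unique (inj₂ refl) (inj₂ refl) _  _  = refl
  evenEnd-unique {e} (inj₁ refl) (inj₂ refl) pv pw =
    contradiction (trans (sym (trans (ends-opposite e) (cong not pv))) pw) true≢false
  evenEnd-unique {e} (inj₂ refl) (inj₁ refl) pv pw =
    contradiction (trans (sym (trans (ends-opposite e) (cong not pw))) pv) true≢false

  lower : ∀ x → k ≤ f x
  lower x = proj₁ (inRange x)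

  upper : ∀ x → f x ≤ M
  upper x = proj₂ (inRange x)

  c : Fin (p G)
  c = proj₁ (oddEnd (fromℕ< q≥1))

  c-odd : isOdd (fv c) ≡ true
  c-odd = proj₂ (proj₂ (oddEnd (fromℕ< q≥1)))

  k<M : k < M
  k<M = k<top k (≤-trans (s≤s z≤n) (toℕ<n c)) q≥1

  -- edge labels are distances of labels in [1, M], hence below M
  edge<M : ∀ e → f (inj₂ e) < M
  edge<M e = subst (_< M) (sym (edgeLabel e))
    (∣-∣<top (≤-trans k≥1 (lower _)) (≤-trans k≥1 (lower _)) (upper _) (upper _))

  above : ∀ x → f x < M → ∃ λ y → f y ≡ suc (f x)
  above x lt = onto (suc (f x)) (m≤n⇒m≤1+n (lower x)) lt

  above-even : ∀ {x} lt → isOdd (f x) ≡ true → isOdd (f (proj₁ (above x lt))) ≡ false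
  above-even {x} lt px = trans (cong isOdd (proj₂ (above x lt))) (cong not px)

  data Kind : Elem G → Set where
    evenVertex : ∀ v → isOdd (fv v) ≡ false → Kind (inj₁ v)
    oddBelow   : ∀ {x} → isOdd (f x) ≡ true → f x < M → Kind x
    oddTop     : ∀ {x} → isOdd (f x) ≡ true → f x ≡ M → Kind x

  kind : ∀ x → Kind x
  kind x with isOdd (f x) in px | f x <? M
  kind (inj₁ v) | false | _      = evenVertex v px
  kind (inj₂ e) | false | _      = contradiction (trans (sym (isOdd-edge e)) px) true≢false
  kind x        | true  | yes lt = oddBelow px lt
  kind x        | true  | no ¬lt = oddTop px (≤-antisym (upper x) (≮⇒≥ ¬lt))

  step : ∀ {x} → Kind x → Elem G
  step (evenVertex v _)    = inj₂ (incidentEdge G v)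
  step (oddBelow {x} _ lt) = proj₁ (above x lt)
  step (oddTop _ _)        = inj₁ c

  T : Elem G → Elem G
  T x = step (kind x)

  -- Distinct even vertices have distinct incident edges (an edge has one
  -- even end), successors are even while edges and c are odd, so T is injective.
  step-injective : ∀ {x y} (κ : Kind x) (κ′ : Kind y) → step κ ≡ step κ′ → x ≡ y
  step-injective (evenVertex v pv) (evenVertex w pw) eq = cong inj₁
    (evenEnd-unique (incidentEdge-touches G v)
                    (subst (λ e → Touches G e w) (sym (inj₂-injective eq)) (incidentEdge-touches G w))
                    pv pw)
  step-injective (evenVertex v _) (oddBelow py lt) eq =
    contradiction (cong f eq) (odd≢even (isOdd-edge _) (above-even lt py))
  step-injective (oddBelow px lt) (evenVertex w _) eq =
    contradiction (cong f (sym eq)) (odd≢even (isOdd-edge _) (above-even lt px))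
  step-injective (oddBelow {x} _ lt) (oddBelow {y} _ lt′) eq = injective (suc-injective (begin
    suc (f x)              ≡⟨ proj₂ (above x lt) ⟨
    f (proj₁ (above x lt)) ≡⟨ cong f eq ⟩
    f (proj₁ (above y lt′)) ≡⟨ proj₂ (above y lt′) ⟩
    suc (f y)              ∎))
    where open ≡-Reasoning
  step-injective (oddBelow px lt) (oddTop _ _) eq =
    contradiction (cong f (sym eq)) (odd≢even c-odd (above-even lt px))
  step-injective (oddTop _ _) (oddBelow py lt) eq =
    contradiction (cong f eq) (odd≢even c-odd (above-even lt py))
  step-injective (oddTop _ fx≡M) (oddTop _ fy≡M) _ = injective (trans fx≡M (sym fy≡M))

  T-injective : Injective _≡_ _≡_ T
  T-injective {x} {y} = step-injective (kind x) (kind y)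

  data Image (y : Elem G) : Set where
    edge   : ∀ e → y ≡ inj₂ e → Image y
    even   : isOdd (f y) ≡ false → Image y
    centre : y ≡ inj₁ c → isOdd M ≡ true → Image y

  step-image : ∀ {x} (κ : Kind x) → Image (step κ)
  step-image (evenVertex v _)  = edge (incidentEdge G v) refl
  step-image (oddBelow px lt)  = even (above-even lt px)
  step-image (oddTop px fx≡M)  = centre refl (trans (cong isOdd (sym fx≡M)) px)

  -- T is an injective self-map of the finite set V ∪ E, so it is onto.
  everyImage : ∀ y → ¬ ¬ Image y
  everyImage y ¬image = injective⇒noGap +↔⊎ T T-injective y
    (λ x Tx≡y → ¬image (subst Image Tx≡y (step-image (kind x))))

  -- An odd vertex u is a value of T only as c with M odd, so u = c and M is odd.
  oddVertex-isCentre : ∀ {u} → isOdd (fv u) ≡ true → u ≡ c × isOdd M ≡ true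
  oddVertex-isCentre {u} pu = decidable-stable ((u ≟ᶠ c) ×-dec (isOdd M ≟ᵇ true))
    (λ ¬goal → everyImage (inj₁ u) λ where
      (edge _ ())
      (even pu′)       → true≢false (trans (sym pu) pu′)
      (centre u≡c pM)  → ¬goal (inj₁-injective u≡c , pM))

  M-odd : isOdd M ≡ true
  M-odd = proj₂ (oddVertex-isCentre c-odd)

  central : ∀ e → Touches G e c
  central e with oddEnd e
  ... | v , e~v , pv = subst (Touches G e) (proj₁ (oddVertex-isCentre pv)) e~v

  -- the top label is carried by a vertex, necessarily the odd vertex c
  top-at-centre : fv c ≡ M
  top-at-centre with onto M (<⇒≤ k<M) ≤-refl
  ... | inj₁ u , fu≡M = subst (λ w → fv w ≡ M)
                              (proj₁ (oddVertex-isCentre (trans (cong isOdd fu≡M) M-odd))) fu≡M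
  ... | inj₂ e , fe≡M = contradiction fe≡M (<⇒≢ (edge<M e))

  M≥1 : 1 ≤ M
  M≥1 = ≤-trans (s≤s z≤n) k<M

  M-1-even : isOdd (M ∸ 1) ≡ false
  M-1-even = begin
    isOdd (M ∸ 1)             ≡⟨ not-involutive _ ⟨
    not (isOdd (suc (M ∸ 1))) ≡⟨ cong (λ n → not (isOdd n)) (suc-∸1 M≥1) ⟩
    not (isOdd M)             ≡⟨ cong not M-odd ⟩
    false                     ∎
    where open ≡-Reasoning

  -- The even label M-1 sits on a leaf w; the edge wc is labelled 1, so k ≤ 1.
  k≡1 : k ≡ 1
  k≡1 with onto (M ∸ 1) (∸-monoˡ-≤ 1 k<M) (m∸n≤m M 1)
  ... | inj₂ e , fe≡M-1 = contradiction fe≡M-1 (odd≢even (isOdd-edge e) M-1-even)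
  ... | inj₁ w , fw≡M-1 = ≤-antisym (subst (k ≤_) spoke-label (lower (inj₂ s))) k≥1
    where
    w≢c : w ≢ c
    w≢c w≡c = odd≢even c-odd M-1-even (trans (cong fv (sym w≡c)) fw≡M-1)
    s : Fin (q G)
    s = incidentEdge G w
    spoke-label : f (inj₂ s) ≡ 1
    spoke-label = begin
      f (inj₂ s)                      ≡⟨ edgeLabel s ⟩
      ∣ fv (src G s) - fv (tgt G s) ∣ ≡⟨ joins-distance G fv (Centred.spoke G c central w≢c) ⟩
      ∣ fv c - fv w ∣                 ≡⟨ cong₂ ∣_-_∣ (trans top-at-centre (sym (suc-∸1 M≥1))) fw≡M-1 ⟩
      ∣ suc (M ∸ 1) - (M ∸ 1) ∣       ≡⟨ ∣suc-n-n∣ (M ∸ 1) ⟩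
      1                               ∎
      where open ≡-Reasoning

  isStar : IsStar G
  isStar = Centred.isStar G c central q≥1

-- Centre, leaves and edges of K(1,n) are indexed by Fin (suc n) ⊎ Fin n:
-- inj₁ zero is the centre, inj₁ (suc j) the leaf j and inj₂ j its edge.
module StarLabel (n : ℕ) where

  starLabel : Fin (suc n) ⊎ Fin n → ℕ
  starLabel (inj₁ zero)    = suc (2 * n)
  starLabel (inj₁ (suc j)) = 2 * suc (toℕ j)
  starLabel (inj₂ j)       = suc (2 * toℕ (opposite j))

  spoke-distance : ∀ j → ∣ starLabel (inj₁ zero) - starLabel (inj₁ (suc j)) ∣ ≡ starLabel (inj₂ j)
  spoke-distance j = begin
    ∣ suc (2 * n) - 2 * suc (toℕ j) ∣ ≡⟨ m≤n⇒∣n-m∣≡n∸m (m≤n⇒m≤1+n 2j+2≤2n) ⟩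
    suc (2 * n) ∸ 2 * suc (toℕ j)     ≡⟨ +-∸-assoc 1 2j+2≤2n ⟩
    suc (2 * n ∸ 2 * suc (toℕ j))     ≡⟨ cong suc (*-distribˡ-∸ 2 n (suc (toℕ j))) ⟨
    suc (2 * (n ∸ suc (toℕ j)))       ≡⟨ cong (λ m → suc (2 * m)) (opposite-prop j) ⟨
    suc (2 * toℕ (opposite j))        ∎
    where
    open ≡-Reasoning
    2j+2≤2n : 2 * suc (toℕ j) ≤ 2 * n
    2j+2≤2n = *-monoʳ-≤ 2 (toℕ<n j)

  centre≢leaf : ∀ j → starLabel (inj₁ zero) ≢ starLabel (inj₁ (suc j))
  centre≢leaf j eq = double≢odd (suc (toℕ j)) n (sym eq)

  centre≢spoke : ∀ j → starLabel (inj₁ zero) ≢ starLabel (inj₂ j)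
  centre≢spoke j eq = <⇒≢ (toℕ<n (opposite j)) (sym (*-cancelˡ-≡ n _ 2 (suc-injective eq)))

  leaf≢spoke : ∀ i j → starLabel (inj₁ (suc i)) ≢ starLabel (inj₂ j)
  leaf≢spoke i j = double≢odd (suc (toℕ i)) (toℕ (opposite j))

  starLabel-injective : Injective _≡_ _≡_ starLabel
  starLabel-injective {inj₁ zero}    {inj₁ zero}    _  = refl
  starLabel-injective {inj₁ zero}    {inj₁ (suc j)} eq = contradiction eq (centre≢leaf j)
  starLabel-injective {inj₁ zero}    {inj₂ j}       eq = contradiction eq (centre≢spoke j)
  starLabel-injective {inj₁ (suc i)} {inj₁ zero}    eq = contradiction (sym eq) (centre≢leaf i)
  starLabel-injective {inj₁ (suc i)} {inj₁ (suc j)} eq =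
    cong (λ l → inj₁ (suc l)) (toℕ-injective (suc-injective (*-cancelˡ-≡ _ _ 2 eq)))
  starLabel-injective {inj₁ (suc i)} {inj₂ j}       eq = contradiction eq (leaf≢spoke i j)
  starLabel-injective {inj₂ i}       {inj₁ zero}    eq = contradiction (sym eq) (centre≢spoke i)
  starLabel-injective {inj₂ i}       {inj₁ (suc j)} eq = contradiction (sym eq) (leaf≢spoke j i)
  starLabel-injective {inj₂ i}       {inj₂ j}       eq = cong inj₂ (begin
    i                       ≡⟨ opposite-involutive i ⟨
    opposite (opposite i)   ≡⟨ cong opposite (toℕ-injective (*-cancelˡ-≡ _ _ 2 (suc-injective eq))) ⟩
    opposite (opposite j)   ≡⟨ opposite-involutive j ⟩
    j                       ∎)
    where open ≡-Reasoning

  starLabel-range : ∀ z → 1 ≤ starLabel z × starLabel z ≤ suc (2 * n)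
  starLabel-range (inj₁ zero)    = s≤s z≤n , ≤-refl
  starLabel-range (inj₁ (suc j)) = s≤s z≤n , m≤n⇒m≤1+n (*-monoʳ-≤ 2 (toℕ<n j))
  starLabel-range (inj₂ j)       = s≤s z≤n , s≤s (*-monoʳ-≤ 2 (<⇒≤ (toℕ<n (opposite j))))

  -- every label in [1, 2n+1] is used: evens on leaves, odds on edges and the centre
  starLabel-onto : ∀ m → 1 ≤ m → m ≤ suc (2 * n) → ∃ λ z → starLabel z ≡ m
  starLabel-onto m 1≤m m≤top with evenOrOdd m
  ... | zero  , inj₁ refl = contradiction 1≤m (λ ())
  ... | suc t , inj₁ refl = inj₁ (suc j) , cong (λ l → 2 * suc l) (toℕ-fromℕ< t<n)
    where
    t<n : t < n
    t<n = *-cancelˡ-≤ 2 (≤-pred (≤∧≢⇒< m≤top (λ eq → double≢odd (suc t) n eq)))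
    j : Fin n
    j = fromℕ< t<n
  ... | t , inj₂ refl with t ≟ n
  ...   | yes refl = inj₁ zero , refl
  ...   | no  t≢n  = inj₂ (opposite j) , trans (cong (λ i → suc (2 * toℕ i)) (opposite-involutive j))
                                             (cong (λ l → suc (2 * l)) (toℕ-fromℕ< t<n))
    where
    t<n : t < n
    t<n = ≤∧≢⇒< (*-cancelˡ-≤ 2 (≤-pred m≤top)) t≢n
    j : Fin n
    j = fromℕ< t<n

module StarIso (G : Graph) (n : ℕ) (σ : Fin (p G) ↔ Fin (suc n))
       (adj : ∀ u v → (Adj G u v → StarAdj (Inverse.to σ u) (Inverse.to σ v))
                    × (StarAdj (Inverse.to σ u) (Inverse.to σ v) → Adj G u v)) where

  open Inverse σ using (to; from; strictlyInverseˡ; strictlyInverseʳ)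
  open StarLabel n

  centre : Fin (p G)
  centre = from zero

  leaf : Fin n → Fin (p G)
  leaf j = from (suc j)

  to⇒from : ∀ {v y} → to v ≡ y → v ≡ from y
  to⇒from {v} eq = trans (sym (strictlyInverseʳ v)) (cong from eq)

  edgeEnds : ∀ e → ∃ λ j → Joins G e centre (leaf j)
  edgeEnds e with starAdj-leaf (proj₁ (adj (src G e) (tgt G e)) (e , inj₁ (refl , refl)))
  ... | j , ends = j , Sum.map (Product.map to⇒from to⇒from) (Product.map to⇒from to⇒from) ends

  leafOf : Fin (q G) → Fin n
  leafOf e = proj₁ (edgeEnds e)

  leafOf-joins : ∀ e → Joins G e centre (leaf (leafOf e))
  leafOf-joins e = proj₂ (edgeEnds e)

  spokeTo-adj : ∀ j → Adj G centre (leaf j)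
  spokeTo-adj j = proj₂ (adj centre (leaf j))
    (inj₁ (strictlyInverseˡ zero , λ eq → zero≢suc (trans (sym eq) (strictlyInverseˡ (suc j)))))

  spokeTo : Fin n → Fin (q G)
  spokeTo j = proj₁ (spokeTo-adj j)

  edges↔leaves : Fin (q G) ↔ Fin n
  edges↔leaves = mk↔ₛ′ leafOf spokeTo leafOf-spokeTo spokeTo-leafOf
    where
    leafOf-spokeTo : ∀ j → leafOf (spokeTo j) ≡ j
    leafOf-spokeTo j = Fin-suc-injective (Injection.injective (↔⇒↣ (↔-sym σ))
      (joins-other G (leafOf-joins (spokeTo j)) (proj₂ (spokeTo-adj j))))
    spokeTo-leafOf : ∀ e → spokeTo (leafOf e) ≡ e
    spokeTo-leafOf e = joins-unique G (proj₂ (spokeTo-adj (leafOf e))) (leafOf-joins e)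

  elems↔star : Elem G ↔ (Fin (suc n) ⊎ Fin n)
  elems↔star = σ ⊎-↔ edges↔leaves

  size : p G + q G ≡ suc (2 * n)
  size = trans (cong₂ _+_ (↔-size σ) (↔-size edges↔leaves))
               (cong (λ m → suc (n + m)) (sym (+-identityʳ n)))

  label : Elem G → ℕ
  label x = starLabel (Inverse.to elems↔star x)

  label-edge : ∀ e → label (inj₂ e) ≡ ∣ label (inj₁ (src G e)) - label (inj₁ (tgt G e)) ∣
  label-edge e = begin
    starLabel (inj₂ l)                                   ≡⟨ spoke-distance l ⟨
    ∣ starLabel (inj₁ zero) - starLabel (inj₁ (suc l)) ∣ ≡⟨ cong₂ (λ a b → ∣ starLabel (inj₁ a) - starLabel (inj₁ b) ∣)
                                                              (strictlyInverseˡ zero) (strictlyInverseˡ (suc l)) ⟨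
    ∣ g centre - g (leaf l) ∣                            ≡⟨ joins-distance G g (leafOf-joins e) ⟨
    ∣ g (src G e) - g (tgt G e) ∣                        ∎
    where
    open ≡-Reasoning
    l : Fin n
    l = leafOf e
    g : Fin (p G) → ℕ
    g v = label (inj₁ v)

  labelling : SuperGraceful 1 G
  labelling = record
    { f         = label
    ; injective = λ eq → Injection.injective (↔⇒↣ elems↔star) (starLabel-injective eq)
    ; inRange   = λ x → Product.map₂ (subst (label x ≤_) (sym size))
                                     (starLabel-range (Inverse.to elems↔star x))
    ; onto      = λ m 1≤m m≤top → Product.map (Inverse.from elems↔star)
                    (λ {z} eq → trans (cong starLabel (Inverse.strictlyInverseˡ elems↔star z)) eq)
                    (starLabel-onto m 1≤m (subst (m ≤_) size m≤top))
    ; edgeLabel = label-edge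
    }

  oddLabelling : HasOddEdgeSGL 1 G
  oddLabelling = labelling , λ e → odd (toℕ (opposite (leafOf e)))

theorem4p2 : (G : Graph) → 1 ≤ q G → (k : ℕ) → 1 ≤ k →
    HasOddEdgeSGL k G ⇔ (k ≡ 1 × IsStar G)
theorem4p2 G q≥1 k k≥1 = mk⇔
  (λ (L , odd-edges) → let open OddEdgeLabelling G q≥1 k k≥1 L odd-edges in k≡1 , isStar)
  (λ { (refl , n , _ , σ , adj) → StarIso.oddLabelling G n σ adj })
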